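{- There is an absolute constant $C>0$ such that for all integers $b > a \geq 1$ with $\gcd(a,b)=1$ and $a+b$ odd, and for every $(x,y)\in\mathbb{Z}^2$ with $\max\{|x|,|y|\}\leq a+b$, we have $\mathrm{N}_{a,b}(x,y) \leq C b$; i.e. $\mathrm{N}_{a,b}(x,y)=O(b)$ uniformly in $a,b$.
   Context: For a finite set $A\subseteq\mathbb{Z}^2$ and $h\geq 1$, let $hA=\{\mathbf{a}_1+\cdots+\mathbf{a}_h : \mathbf{a}_1,\dots,\mathbf{a}_h\in A\}$ be the $h$-fold sumset. Define $A(0,0):=0$ and, for $(x,y)\neq(0,0)$, $A(x,y):=\min\{h\geq 1 : (x,y)\in hA\}$. For integers $a,b\geq 1$, the $(a,b)$-knight is $\mathrm{N}_{a,b}=\{(a,b),(b,a),(-a,b),(-b,a),(-b,-a),(-a,-b),(a,-b),(b,-a)\}$, and $\mathrm{N}_{a,b}(x,y)$ denotes $A(x,y)$ for $A=\mathrm{N}_{a,b}$. -}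

module Defs where

open import Data.Nat using (ℕ; zero; suc; _<_)
open import Data.Integer using (ℤ; +_; -_; _+_)
open import Data.Product using (_×_; _,_; ∃)
open import Data.List using (List; []; _∷_; length; foldr)
open import Data.List.Relation.Unary.All using (All)
open import Data.List.Membership.Propositional using (_∈_)
open import Relation.Binary.PropositionalEquality using (_≡_)
open import Relation.Nullary using (¬_)

ℤ² : Set
ℤ² = ℤ × ℤ

_⊕_ : ℤ² → ℤ² → ℤ²
(x₁ , y₁) ⊕ (x₂ , y₂) = (x₁ + x₂ , y₁ + y₂)

origin : ℤ²
origin = (+ 0 , + 0)

sumPts : List ℤ² → ℤ²
sumPts = foldr _⊕_ origin

knight : ℕ → ℕ → List ℤ²
knight a b =
  (+ a , + b) ∷ (+ b , + a) ∷ (- (+ a) , + b) ∷ (- (+ b) , + a) ∷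
  (- (+ b) , - (+ a)) ∷ (- (+ a) , - (+ b)) ∷ (+ a , - (+ b)) ∷ (+ b , - (+ a)) ∷ []

InSumset : List ℤ² → ℕ → ℤ² → Set
InSumset A h p = ∃ λ (as : List ℤ²) → length as ≡ h × All (_∈ A) as × sumPts as ≡ p

-- A(p) as in the paper: A(0,0) = 0, otherwise the least h ≥ 1 with p ∈ hA.
-- IsA A p n means "A(p) is defined and equals n".
data IsA (A : List ℤ²) (p : ℤ²) : ℕ → Set where
  at-origin : p ≡ origin → IsA A p 0
  least     : ∀ {h} → ¬ (p ≡ origin) → InSumset A (suc h) p →
              (∀ k → k < h → ¬ InSumset A (suc k) p) →
              IsA A p (suc h)

IsKnightDist : ℕ → ℕ → ℤ² → ℕ → Set
IsKnightDist a b = IsA (knight a b)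

-- Two knight moves give (2a, 0) and (2b, 0). As gcd(a, b) = 1, every integer m is r a + t b
-- with 0 ≤ r < b, and |m| ≤ 2b forces |t| ≤ a + 2; so (2m, 0) is a sum of at most 2r + 2|t| ≤ 6b
-- moves, and by the swap symmetry of the knight so is (0, 2m). As a + b is odd, some move (c, d)
-- has c odd and d even; adding at most one (c, d) and one (d, c) to (x, y) fixes both parities
-- and leaves (2m₁, 2m₂) with |mᵢ| ≤ a + b. Hence (x, y) ∈ hN for some h ≤ 2 + 12b ≤ 14b, and
-- since membership in hN is decidable, the least such h exists.
{-# OPTIONS --safe #-}
module Submission where

open import Defs
open import Data.Integer using (ℤ; ∣_∣)
open import Data.Nat.DivMod using (_%_)
open import Data.Nat.GCD using (gcd)
open import Data.Product using (∃; _×_; _,_)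
open import Relation.Binary.PropositionalEquality using (_≡_)

-- Inside this module ℤ arithmetic is unqualified and ℕ arithmetic is written ℕ.+, ℕ.*, so that
-- the statement at the end can use the ℕ operators unqualified.
module KnightDistance where

  open import Data.Fin using (Fin; #_)
  open import Data.Integer as ℤ using (+_; -_; -[1+_]; _+_; _-_; _*_; 0ℤ; 1ℤ; _%ℕ_; _/ℕ_)
  import Data.Integer.Properties as ℤ
  open import Data.Integer.DivMod using (a≡a%ℕn+[a/ℕn]*n; n%ℕd<d)
  open import Data.Integer.Tactic.RingSolver using (solve-∀)
  open import Data.List using (List; []; _∷_; _++_; map; lookup)
  open import Data.List.Properties using (length-++; length-map)
  open import Data.List.Relation.Unary.All using ([]; _∷_)
  import Data.List.Relation.Unary.All as All
  import Data.List.Relation.Unary.All.Properties as All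
  open import Data.List.Relation.Unary.Any using (Any; here; there; any?)
  open import Data.List.Membership.Propositional using (_∈_; find; lose)
  open import Data.List.Membership.Propositional.Properties using (∈-lookup)
  open import Data.Nat as ℕ using (ℕ; zero; suc; _≤_; _<_; z≤n; s≤s; NonZero)
  import Data.Nat.Properties as ℕ
  open import Data.Nat.Coprimality using (gcd≡1⇒coprime; coprime-Bézout)
  open import Data.Nat.DivMod using (%-distribˡ-+; m%n<n)
  open import Data.Nat.GCD using (module Bézout)
  import Data.Nat.Tactic.RingSolver as ℕ-Solver
  open import Data.Product using (∃₂; swap)
  open import Data.Product.Properties using (≡-dec)
  open import Data.Sum using (_⊎_; inj₁; inj₂)
  open import Function using (_∘_)
  open import Relation.Binary.Definitions using (DecidableEquality)
  open import Relation.Binary.PropositionalEquality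
    using (refl; sym; trans; cong; cong₂; subst; module ≡-Reasoning)
  open import Relation.Nullary using (¬_; Dec; yes; no)
  open import Relation.Nullary.Decidable using (map′)
  open import Relation.Unary using (Decidable)

  module _ {P : ℕ → Set} (P? : Decidable P) where

    Least : Set
    Least = ∃ λ k → P k × (∀ j → j < k → ¬ P j)

    search-from : ∀ i n → (∀ j → j < i → ¬ P j) → P (n ℕ.+ i) → Least
    search-from i zero    below p = i , p , below
    search-from i (suc n) below p with P? i
    ... | yes pᵢ = i , pᵢ , below
    ... | no ¬pᵢ = search-from (suc i) n below′ (subst P (sym (ℕ.+-suc n i)) p)
      where
      below′ : ∀ j → j < suc i → ¬ P j
      below′ j j<1+i with ℕ.m<1+n⇒m<n∨m≡n j<1+i
      ... | inj₁ j<i  = below j j<i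
      ... | inj₂ refl = ¬pᵢ

    least-witness : ∀ {h} → P h → Least
    least-witness {h} p = search-from 0 h (λ _ ()) (subst P (sym (ℕ.+-identityʳ h)) p)

  _≟ᵖ_ : DecidableEquality ℤ²
  _≟ᵖ_ = ≡-dec ℤ._≟_ ℤ._≟_

  ⊕-assoc : ∀ p q r → (p ⊕ q) ⊕ r ≡ p ⊕ (q ⊕ r)
  ⊕-assoc (x₁ , y₁) (x₂ , y₂) (x₃ , y₃) =
    cong₂ _,_ (ℤ.+-assoc x₁ x₂ x₃) (ℤ.+-assoc y₁ y₂ y₃)

  ⊕-identityˡ : ∀ p → origin ⊕ p ≡ p
  ⊕-identityˡ (x , y) = cong₂ _,_ (ℤ.+-identityˡ x) (ℤ.+-identityˡ y)

  ⊕-identityʳ : ∀ p → p ⊕ origin ≡ p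
  ⊕-identityʳ (x , y) = cong₂ _,_ (ℤ.+-identityʳ x) (ℤ.+-identityʳ y)

  _⊖_ : ℤ² → ℤ² → ℤ²
  (x₁ , y₁) ⊖ (x₂ , y₂) = (x₁ - x₂ , y₁ - y₂)

  i+[j-i]≡j : ∀ i j → i + (j - i) ≡ j
  i+[j-i]≡j = solve-∀

  [i+j]-i≡j : ∀ i j → (i + j) - i ≡ j
  [i+j]-i≡j = solve-∀

  ⊕-⊖ : ∀ p q → p ⊕ (q ⊖ p) ≡ q
  ⊕-⊖ (x₁ , y₁) (x₂ , y₂) = cong₂ _,_ (i+[j-i]≡j x₁ x₂) (i+[j-i]≡j y₁ y₂)

  ⊖-⊕ : ∀ p q → (p ⊕ q) ⊖ p ≡ q
  ⊖-⊕ (x₁ , y₁) (x₂ , y₂) = cong₂ _,_ ([i+j]-i≡j x₁ x₂) ([i+j]-i≡j y₁ y₂)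

  negate : ℤ² → ℤ²
  negate (x , y) = (- x , - y)

  infixr 7 _·_
  _·_ : ℤ → ℤ² → ℤ²
  k · (x , y) = (k * x , k * y)

  sumPts-++ : ∀ ps qs → sumPts (ps ++ qs) ≡ sumPts ps ⊕ sumPts qs
  sumPts-++ []       qs = sym (⊕-identityˡ (sumPts qs))
  sumPts-++ (p ∷ ps) qs =
    trans (cong (p ⊕_) (sumPts-++ ps qs)) (sym (⊕-assoc p (sumPts ps) (sumPts qs)))

  record Additive (f : ℤ² → ℤ²) : Set where
    field
      map-origin : f origin ≡ origin
      map-⊕      : ∀ p q → f (p ⊕ q) ≡ f p ⊕ f q

  negate-additive : Additive negate
  negate-additive = record
    { map-origin = refl
    ; map-⊕      = λ (x₁ , y₁) (x₂ , y₂) →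
                     cong₂ _,_ (ℤ.neg-distrib-+ x₁ x₂) (ℤ.neg-distrib-+ y₁ y₂)
    }

  swap-additive : Additive swap
  swap-additive = record { map-origin = refl ; map-⊕ = λ _ _ → refl }

  sumPts-map : ∀ {f} → Additive f → ∀ ps → sumPts (map f ps) ≡ f (sumPts ps)
  sumPts-map f-additive []           = sym (Additive.map-origin f-additive)
  sumPts-map {f} f-additive (p ∷ ps) = begin
    f p ⊕ sumPts (map f ps) ≡⟨ cong (f p ⊕_) (sumPts-map f-additive ps) ⟩
    f p ⊕ f (sumPts ps)     ≡⟨ Additive.map-⊕ f-additive p (sumPts ps) ⟨
    f (p ⊕ sumPts ps)       ∎
    where open ≡-Reasoning

  module _ {A : List ℤ²} where

    InSumset-zero : ∀ {p} → InSumset A 0 p → p ≡ origin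
    InSumset-zero ([] , refl , [] , origin≡p) = sym origin≡p

    InSumset-∷ : ∀ {h m q} → m ∈ A → InSumset A h q → InSumset A (suc h) (m ⊕ q)
    InSumset-∷ {m = m} m∈A (ms , refl , ms⊆A , refl) = m ∷ ms , refl , m∈A ∷ ms⊆A , refl

    InSumset-++ : ∀ {h k p q} → InSumset A h p → InSumset A k q → InSumset A (h ℕ.+ k) (p ⊕ q)
    InSumset-++ (ps , refl , ps⊆A , refl) (qs , refl , qs⊆A , refl) =
      ps ++ qs , length-++ ps , All.++⁺ ps⊆A qs⊆A , sumPts-++ ps qs

    InSumset-map : ∀ {f h p} → Additive f → (∀ {m} → m ∈ A → f m ∈ A) →
                   InSumset A h p → InSumset A h (f p)
    InSumset-map {f} f-additive f-closed (ps , refl , ps⊆A , refl) =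
      map f ps , length-map f ps , All.map⁺ (All.map f-closed ps⊆A) , sumPts-map f-additive ps

    InSumset? : ∀ h p → Dec (InSumset A h p)
    InSumset? zero    p =
      map′ (λ origin≡p → [] , refl , [] , origin≡p) (sym ∘ InSumset-zero) (origin ≟ᵖ p)
    InSumset? (suc h) p = map′ from to (any? (λ m → InSumset? h (p ⊖ m)) A)
      where
      from : Any (λ m → InSumset A h (p ⊖ m)) A → InSumset A (suc h) p
      from found with m , m∈A , p⊖m∈hA ← find found =
        subst (InSumset A (suc h)) (⊕-⊖ m p) (InSumset-∷ m∈A p⊖m∈hA)
      to : InSumset A (suc h) p → Any (λ m → InSumset A h (p ⊖ m)) A
      to (m ∷ ms , refl , m∈A ∷ ms⊆A , m+ms≡p) =
        lose m∈A (ms , refl , ms⊆A , trans (sym (⊖-⊕ m (sumPts ms))) (cong (_⊖ m) m+ms≡p))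

    InSumset≤ : ℕ → ℤ² → Set
    InSumset≤ c p = ∃ λ h → h ≤ c × InSumset A h p

    InSumset≤⇒IsA : ∀ {c p} → InSumset≤ c p → ∃ λ n → IsA A p n × n ≤ c
    InSumset≤⇒IsA (zero , _ , p∈0A) = 0 , at-origin (InSumset-zero p∈0A) , z≤n
    InSumset≤⇒IsA {p = p} (suc h , 1+h≤c , p∈A) with p ≟ᵖ origin
    ... | yes p≡origin = 0 , at-origin p≡origin , z≤n
    ... | no p≢origin with k , p∈A′ , minimal ← least-witness (λ k → InSumset? (suc k) p) p∈A =
      suc k , least p≢origin p∈A′ minimal ,
      ℕ.≤-trans (s≤s (ℕ.≮⇒≥ (λ h<k → minimal h h<k p∈A))) 1+h≤c

    InSumset≤-∈ : ∀ {m} → m ∈ A → InSumset≤ 1 m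
    InSumset≤-∈ {m} m∈A =
      1 , ℕ.≤-refl , subst (InSumset A 1) (⊕-identityʳ m) (InSumset-∷ m∈A ([] , refl , [] , refl))

    InSumset≤-⊕ : ∀ {c d p q} → InSumset≤ c p → InSumset≤ d q → InSumset≤ (c ℕ.+ d) (p ⊕ q)
    InSumset≤-⊕ (h , h≤c , p∈hA) (k , k≤d , q∈kA) =
      h ℕ.+ k , ℕ.+-mono-≤ h≤c k≤d , InSumset-++ p∈hA q∈kA

    InSumset≤-mono : ∀ {c d p} → c ≤ d → InSumset≤ c p → InSumset≤ d p
    InSumset≤-mono c≤d (h , h≤c , p∈hA) = h , ℕ.≤-trans h≤c c≤d , p∈hA

    InSumset≤-map : ∀ {f c p} → Additive f → (∀ {m} → m ∈ A → f m ∈ A) →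
                    InSumset≤ c p → InSumset≤ c (f p)
    InSumset≤-map f-additive f-closed (h , h≤c , p∈hA) =
      h , h≤c , InSumset-map f-additive f-closed p∈hA

    InSumset≤-ℕ· : ∀ {c p} k → InSumset≤ c p → InSumset≤ (k ℕ.* c) (+ k · p)
    InSumset≤-ℕ· zero    _ = 0 , z≤n , [] , refl , [] , refl
    InSumset≤-ℕ· {p = x , y} (suc k) p∈ =
      subst (InSumset≤ _) (sym (cong₂ _,_ (ℤ.suc-* (+ k) x) (ℤ.suc-* (+ k) y)))
        (InSumset≤-⊕ p∈ (InSumset≤-ℕ· k p∈))

    InSumset≤-· : (∀ {m} → m ∈ A → negate m ∈ A) →
                  ∀ {c p} k → InSumset≤ c p → InSumset≤ (∣ k ∣ ℕ.* c) (k · p)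
    InSumset≤-· _                       (+ k)    p∈ = InSumset≤-ℕ· k p∈
    InSumset≤-· A-symmetric {p = x , y} -[1+ k ] p∈ =
      subst (InSumset≤ _) (cong₂ _,_ (ℤ.neg-distribˡ-* (+ suc k) x) (ℤ.neg-distribˡ-* (+ suc k) y))
        (InSumset≤-map negate-additive A-symmetric (InSumset≤-ℕ· (suc k) p∈))

    InSumset≤-double : ∀ {x y} → (x , y) ∈ A → (x , - y) ∈ A → InSumset≤ 2 (+ 2 * x , 0ℤ)
    InSumset≤-double {x} {y} p∈A p′∈A =
      subst (InSumset≤ 2) (cong₂ _,_ (i+i≡2i x) (ℤ.+-inverseʳ y))
        (InSumset≤-⊕ (InSumset≤-∈ p∈A) (InSumset≤-∈ p′∈A))
      where
      i+i≡2i : ∀ i → i + i ≡ + 2 * i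
      i+i≡2i = solve-∀

  1+*-toℤ : ∀ u v s t → 1 ℕ.+ u ℕ.* v ≡ s ℕ.* t → 1ℤ + + u * + v ≡ + s * + t
  1+*-toℤ u v s t eq = begin
    1ℤ + + u * + v     ≡⟨ cong (_+_ 1ℤ) (ℤ.pos-* u v) ⟨
    + (1 ℕ.+ u ℕ.* v)  ≡⟨ cong +_ eq ⟩
    + (s ℕ.* t)        ≡⟨ ℤ.pos-* s t ⟩
    + s * + t          ∎
    where open ≡-Reasoning

  -- Opaque because the coefficients come from a well-founded recursion that the unifier would
  -- otherwise try to evaluate.
  opaque
    coprime⇒bézout : ∀ {a b} → gcd a b ≡ 1 → ∃₂ λ s t → s * + a + t * + b ≡ 1ℤ
    coprime⇒bézout {a} {b} gcd≡1 with coprime-Bézout (gcd≡1⇒coprime {a} {b} gcd≡1)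
    ... | Bézout.+- x y 1+yb≡xa = + x , - + y ,
      trans (cong (_+ - + y * + b) (sym (1+*-toℤ y b x a 1+yb≡xa))) (cancel (+ y) (+ b))
      where
      cancel : ∀ u v → (1ℤ + u * v) + - u * v ≡ 1ℤ
      cancel = solve-∀
    ... | Bézout.-+ x y 1+xa≡yb = - + x , + y ,
      trans (cong (_+_ (- + x * + a)) (sym (1+*-toℤ x a y b 1+xa≡yb))) (cancel (+ x) (+ a))
      where
      cancel : ∀ u v → - u * v + (1ℤ + u * v) ≡ 1ℤ
      cancel = solve-∀

  coprime⇒representation : ∀ {a b} .{{_ : NonZero b}} → gcd a b ≡ 1 →
                           ∀ m → ∃ λ r → r < b × ∃ λ t → m ≡ + r * + a + t * + b
  coprime⇒representation {a} {b} gcd≡1 m with s , t , sa+tb≡1 ← coprime⇒bézout gcd≡1 =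
    r , n%ℕd<d (m * s) b , q * + a + m * t , (begin
      m                                  ≡⟨ ℤ.*-identityʳ m ⟨
      m * 1ℤ                             ≡⟨ cong (m *_) sa+tb≡1 ⟨
      m * (s * + a + t * + b)            ≡⟨ distribute m s t (+ a) (+ b) ⟩
      m * s * + a + m * t * + b          ≡⟨ cong (λ z → z * + a + m * t * + b) (a≡a%ℕn+[a/ℕn]*n (m * s) b) ⟩
      (+ r + q * + b) * + a + m * t * + b ≡⟨ collect (+ r) q (+ a) (+ b) (m * t) ⟩
      + r * + a + (q * + a + m * t) * + b ∎)
    where
    open ≡-Reasoning
    r : ℕ
    r = m * s %ℕ b
    q : ℤ
    q = m * s /ℕ b
    distribute : ∀ m s t a b → m * (s * a + t * b) ≡ m * s * a + m * t * b
    distribute = solve-∀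
    collect : ∀ r q a b u → (r + q * b) * a + u * b ≡ r * a + (q * a + u) * b
    collect = solve-∀

  ∣j∣≤∣i+j∣+∣i∣ : ∀ i j → ∣ j ∣ ≤ ∣ i + j ∣ ℕ.+ ∣ i ∣
  ∣j∣≤∣i+j∣+∣i∣ i j =
    subst (λ k → ∣ k ∣ ≤ ∣ i + j ∣ ℕ.+ ∣ i ∣) ([i+j]-i≡j i j) (ℤ.∣i-j∣≤∣i∣+∣j∣ (i + j) i)

  n+n≡2*n : ∀ n → n ℕ.+ n ≡ 2 ℕ.* n
  n+n≡2*n n = cong (n ℕ.+_) (sym (ℕ.+-identityʳ n))

  representation-bound : ∀ {a b k r m} t .{{_ : NonZero b}} → r < b → m ≡ + r * + a + t * + b →
                         ∣ m ∣ ≤ k ℕ.* b → ∣ t ∣ ≤ k ℕ.+ a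
  representation-bound {a} {b} {k} {r} {m} t r<b m≡ra+tb ∣m∣≤kb =
    ℕ.*-cancelʳ-≤ ∣ t ∣ (k ℕ.+ a) b (begin
      ∣ t ∣ ℕ.* b                                ≡⟨ ℤ.abs-* t (+ b) ⟨
      ∣ t * + b ∣                                ≤⟨ ∣j∣≤∣i+j∣+∣i∣ (+ r * + a) (t * + b) ⟩
      ∣ + r * + a + t * + b ∣ ℕ.+ ∣ + r * + a ∣  ≡⟨ cong₂ ℕ._+_ (cong ∣_∣ (sym m≡ra+tb)) (ℤ.abs-* (+ r) (+ a)) ⟩
      ∣ m ∣ ℕ.+ r ℕ.* a                          ≤⟨ ℕ.+-mono-≤ ∣m∣≤kb (ℕ.*-monoˡ-≤ a (ℕ.<⇒≤ r<b)) ⟩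
      k ℕ.* b ℕ.+ b ℕ.* a                        ≡⟨ cong (k ℕ.* b ℕ.+_) (ℕ.*-comm b a) ⟩
      k ℕ.* b ℕ.+ a ℕ.* b                        ≡⟨ ℕ.*-distribʳ-+ b k a ⟨
      (k ℕ.+ a) ℕ.* b                            ∎)
    where open ℕ.≤-Reasoning

  opposite-parity : ∀ a b → (a ℕ.+ b) % 2 ≡ 1 → a % 2 ≡ 1 × b % 2 ≡ 0 ⊎ a % 2 ≡ 0 × b % 2 ≡ 1
  opposite-parity a b a+b-odd
    with a % 2 | m%n<n a 2 | b % 2 | m%n<n b 2 | trans (sym (%-distribˡ-+ a b 2)) a+b-odd
  ... | 0           | _            | 0           | _            | ()
  ... | 0           | _            | 1           | _            | _ = inj₂ (refl , refl)
  ... | 1           | _            | 0           | _            | _ = inj₁ (refl , refl)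
  ... | 1           | _            | 1           | _            | ()
  ... | suc (suc _) | s≤s (s≤s ()) | _           | _            | _
  ... | _           | _            | suc (suc _) | s≤s (s≤s ()) | _

  parity-shift : ∀ x u v e → u %ℕ 2 ≡ 1 → v %ℕ 2 ≡ 0 →
                 ∃ λ m → x ≡ (+ (x %ℕ 2) * u + + e * v) + + 2 * m
  parity-shift x u v e u-odd v-even = m , (begin
    x                                                        ≡⟨ a≡a%ℕn+[a/ℕn]*n x 2 ⟩
    + ε + q * + 2                                            ≡⟨ regroup (+ ε) (+ e) q U V ⟩
    (+ ε * (1ℤ + U * + 2) + + e * (0ℤ + V * + 2)) + + 2 * m  ≡⟨ cong₂ (λ u′ v′ → (+ ε * u′ + + e * v′) + + 2 * m)
                                                                      (split u u-odd) (split v v-even) ⟨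
    (+ ε * u + + e * v) + + 2 * m                            ∎)
    where
    open ≡-Reasoning
    ε : ℕ
    ε = x %ℕ 2
    q U V m : ℤ
    q = x /ℕ 2
    U = u /ℕ 2
    V = v /ℕ 2
    m = q - + ε * U - + e * V
    split : ∀ w {ρ} → w %ℕ 2 ≡ ρ → w ≡ + ρ + w /ℕ 2 * + 2
    split w refl = a≡a%ℕn+[a/ℕn]*n w 2
    regroup : ∀ ε e q U V →
              ε + q * + 2 ≡ (ε * (1ℤ + U * + 2) + e * (0ℤ + V * + 2)) + + 2 * (q - ε * U - e * V)
    regroup = solve-∀

  halve-bound : ∀ {x n} w m → x ≡ w + + 2 * m → ∣ x ∣ ≤ n → ∣ w ∣ ≤ n → ∣ m ∣ ≤ n
  halve-bound {x} {n} w m x≡w+2m ∣x∣≤n ∣w∣≤n = ℕ.*-cancelˡ-≤ 2 (begin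
    2 ℕ.* ∣ m ∣                  ≡⟨ ℤ.abs-* (+ 2) m ⟨
    ∣ + 2 * m ∣                  ≤⟨ ∣j∣≤∣i+j∣+∣i∣ w (+ 2 * m) ⟩
    ∣ w + + 2 * m ∣ ℕ.+ ∣ w ∣    ≡⟨ cong (λ k → ∣ k ∣ ℕ.+ ∣ w ∣) x≡w+2m ⟨
    ∣ x ∣ ℕ.+ ∣ w ∣              ≤⟨ ℕ.+-mono-≤ ∣x∣≤n ∣w∣≤n ⟩
    n ℕ.+ n                      ≡⟨ n+n≡2*n n ⟩
    2 ℕ.* n                      ∎)
    where open ℕ.≤-Reasoning

  combination-bound : ∀ {e f} c d → e ≤ 1 → f ≤ 1 → ∣ + e * + c + + f * + d ∣ ≤ c ℕ.+ d
  combination-bound {e} {f} c d e≤1 f≤1 = begin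
    ∣ + e * + c + + f * + d ∣          ≤⟨ ℤ.∣i+j∣≤∣i∣+∣j∣ (+ e * + c) (+ f * + d) ⟩
    ∣ + e * + c ∣ ℕ.+ ∣ + f * + d ∣    ≡⟨ cong₂ ℕ._+_ (ℤ.abs-* (+ e) (+ c)) (ℤ.abs-* (+ f) (+ d)) ⟩
    e ℕ.* c ℕ.+ f ℕ.* d                ≤⟨ ℕ.+-mono-≤ (ℕ.*-monoˡ-≤ c e≤1) (ℕ.*-monoˡ-≤ d f≤1) ⟩
    1 ℕ.* c ℕ.+ 1 ℕ.* d                ≡⟨ cong₂ ℕ._+_ (ℕ.*-identityˡ c) (ℕ.*-identityˡ d) ⟩
    c ℕ.+ d                            ∎
    where open ℕ.≤-Reasoning

  module Knight (a b : ℕ) where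

    move : (i : Fin 8) → lookup (knight a b) i ∈ knight a b
    move = ∈-lookup

    knight-negate : ∀ {m} → m ∈ knight a b → negate m ∈ knight a b
    knight-negate (here refl)                                        = move (# 5)
    knight-negate (there (here refl))                                = move (# 4)
    knight-negate (there (there (here refl)))
      rewrite ℤ.neg-involutive (+ a)                                 = move (# 6)
    knight-negate (there (there (there (here refl))))
      rewrite ℤ.neg-involutive (+ b)                                 = move (# 7)
    knight-negate (there (there (there (there (here refl)))))
      rewrite ℤ.neg-involutive (+ a) | ℤ.neg-involutive (+ b)        = move (# 1)
    knight-negate (there (there (there (there (there (here refl))))))
      rewrite ℤ.neg-involutive (+ a) | ℤ.neg-involutive (+ b)        = move (# 0)
    knight-negate (there (there (there (there (there (there (here refl)))))))
      rewrite ℤ.neg-involutive (+ b)                                 = move (# 2)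
    knight-negate (there (there (there (there (there (there (there (here refl))))))))
      rewrite ℤ.neg-involutive (+ a)                                 = move (# 3)

    knight-swap : ∀ {m} → m ∈ knight a b → swap m ∈ knight a b
    knight-swap (here refl)                                                          = move (# 1)
    knight-swap (there (here refl))                                                  = move (# 0)
    knight-swap (there (there (here refl)))                                          = move (# 7)
    knight-swap (there (there (there (here refl))))                                  = move (# 6)
    knight-swap (there (there (there (there (here refl)))))                          = move (# 5)
    knight-swap (there (there (there (there (there (here refl))))))                  = move (# 4)
    knight-swap (there (there (there (there (there (there (here refl)))))))          = move (# 3)
    knight-swap (there (there (there (there (there (there (there (here refl)))))))) = move (# 2)

    odd-even-move : (a ℕ.+ b) % 2 ≡ 1 →
                    ∃₂ λ c d → (+ c , + d) ∈ knight a b × c % 2 ≡ 1 × d % 2 ≡ 0 × c ℕ.+ d ≡ a ℕ.+ b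
    odd-even-move a+b-odd with opposite-parity a b a+b-odd
    ... | inj₁ (a-odd , b-even) = a , b , move (# 0) , a-odd , b-even , refl
    ... | inj₂ (a-even , b-odd) = b , a , move (# 1) , b-odd , a-even , ℕ.+-comm b a

    knight-parity-split : (a ℕ.+ b) % 2 ≡ 1 → ∀ x y → ∣ x ∣ ≤ a ℕ.+ b → ∣ y ∣ ≤ a ℕ.+ b →
      ∃ λ v → InSumset≤ {knight a b} 2 v × ∃₂ λ m₁ m₂ →
        ∣ m₁ ∣ ≤ a ℕ.+ b × ∣ m₂ ∣ ≤ a ℕ.+ b × (x , y) ≡ v ⊕ (+ 2 * m₁ , + 2 * m₂)
    knight-parity-split a+b-odd x y ∣x∣≤a+b ∣y∣≤a+b
      with c , d , cd∈K , c-odd , d-even , c+d≡a+b ← odd-even-move a+b-odd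
      with m₁ , x≡ ← parity-shift x (+ c) (+ d) (y %ℕ 2) c-odd d-even
         | m₂ , y≡ ← parity-shift y (+ c) (+ d) (x %ℕ 2) c-odd d-even =
      (+ ε₁ · (+ c , + d)) ⊕ (+ ε₂ · (+ d , + c)) , corner , m₁ , m₂ ,
      halve-bound (+ ε₁ * + c + + ε₂ * + d) m₁ x≡ ∣x∣≤a+b (corner-bound ε₁<2 ε₂<2) ,
      halve-bound (+ ε₂ * + c + + ε₁ * + d) m₂ y≡ ∣y∣≤a+b (corner-bound ε₂<2 ε₁<2) ,
      cong₂ _,_ x≡ (trans y≡ (cong (_+ + 2 * m₂) (ℤ.+-comm (+ ε₂ * + c) (+ ε₁ * + d))))
      where
      ε₁ ε₂ : ℕ
      ε₁ = x %ℕ 2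
      ε₂ = y %ℕ 2
      ε₁<2 : ε₁ < 2
      ε₁<2 = n%ℕd<d x 2
      ε₂<2 : ε₂ < 2
      ε₂<2 = n%ℕd<d y 2
      corner-bound : ∀ {e f} → e < 2 → f < 2 → ∣ + e * + c + + f * + d ∣ ≤ a ℕ.+ b
      corner-bound e<2 f<2 =
        ℕ.≤-trans (combination-bound c d (ℕ.≤-pred e<2) (ℕ.≤-pred f<2)) (ℕ.≤-reflexive c+d≡a+b)
      corner : InSumset≤ {knight a b} 2 ((+ ε₁ · (+ c , + d)) ⊕ (+ ε₂ · (+ d , + c)))
      corner =
        InSumset≤-mono (ℕ.+-mono-≤ (ℕ.*-monoˡ-≤ 1 (ℕ.≤-pred ε₁<2)) (ℕ.*-monoˡ-≤ 1 (ℕ.≤-pred ε₂<2)))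
          (InSumset≤-⊕ (InSumset≤-ℕ· ε₁ (InSumset≤-∈ cd∈K))
                       (InSumset≤-ℕ· ε₂ (InSumset≤-∈ (knight-swap cd∈K))))

  module _ {a b : ℕ} (a<b : a < b) (gcd≡1 : gcd a b ≡ 1) where
    open Knight a b

    private instance
      b-nonZero : NonZero b
      b-nonZero = ℕ.>-nonZero (ℕ.m<n⇒0<n a<b)

    a+b≤2b : a ℕ.+ b ≤ 2 ℕ.* b
    a+b≤2b = ℕ.≤-trans (ℕ.+-monoˡ-≤ b (ℕ.<⇒≤ a<b)) (ℕ.≤-reflexive (n+n≡2*n b))

    2+a≤2b : 2 ℕ.+ a ≤ 2 ℕ.* b
    2+a≤2b = ℕ.≤-trans (ℕ.+-mono-≤ (ℕ.m<n⇒0<n a<b) a<b) (ℕ.≤-reflexive (n+n≡2*n b))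

    knight-horizontal : ∀ m → ∣ m ∣ ≤ a ℕ.+ b → InSumset≤ {knight a b} (6 ℕ.* b) (+ 2 * m , 0ℤ)
    knight-horizontal m ∣m∣≤a+b
      with r , r<b , t , m≡ra+tb ← coprime⇒representation {a} {b} gcd≡1 m =
      InSumset≤-mono cost (subst (InSumset≤ _) point
        (InSumset≤-⊕ (InSumset≤-· knight-negate (+ r) (InSumset≤-double (move (# 0)) (move (# 6))))
                     (InSumset≤-· knight-negate t (InSumset≤-double (move (# 1)) (move (# 7))))))
      where
      combine : ∀ r t a b → r * (+ 2 * a) + t * (+ 2 * b) ≡ + 2 * (r * a + t * b)
      combine = solve-∀
      vanish : ∀ r t → r * 0ℤ + t * 0ℤ ≡ 0ℤ
      vanish = solve-∀
      point : (+ r · (+ 2 * + a , 0ℤ)) ⊕ (t · (+ 2 * + b , 0ℤ)) ≡ (+ 2 * m , 0ℤ)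
      point = cong₂ _,_ (trans (combine (+ r) t (+ a) (+ b)) (cong (+ 2 *_) (sym m≡ra+tb)))
                        (vanish (+ r) t)
      ∣t∣≤2+a : ∣ t ∣ ≤ 2 ℕ.+ a
      ∣t∣≤2+a = representation-bound t r<b m≡ra+tb (ℕ.≤-trans ∣m∣≤a+b a+b≤2b)
      sum≡6*n : ∀ n → n ℕ.* 2 ℕ.+ 2 ℕ.* n ℕ.* 2 ≡ 6 ℕ.* n
      sum≡6*n = ℕ-Solver.solve-∀
      cost : r ℕ.* 2 ℕ.+ ∣ t ∣ ℕ.* 2 ≤ 6 ℕ.* b
      cost = ℕ.≤-trans
        (ℕ.+-mono-≤ (ℕ.*-monoˡ-≤ 2 (ℕ.<⇒≤ r<b)) (ℕ.*-monoˡ-≤ 2 (ℕ.≤-trans ∣t∣≤2+a 2+a≤2b)))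
        (ℕ.≤-reflexive (sum≡6*n b))

    knight-even : ∀ m₁ m₂ → ∣ m₁ ∣ ≤ a ℕ.+ b → ∣ m₂ ∣ ≤ a ℕ.+ b →
                  InSumset≤ {knight a b} (6 ℕ.* b ℕ.+ 6 ℕ.* b) (+ 2 * m₁ , + 2 * m₂)
    knight-even m₁ m₂ ∣m₁∣≤a+b ∣m₂∣≤a+b =
      subst (InSumset≤ _) (cong₂ _,_ (ℤ.+-identityʳ (+ 2 * m₁)) (ℤ.+-identityˡ (+ 2 * m₂)))
        (InSumset≤-⊕ (knight-horizontal m₁ ∣m₁∣≤a+b)
                     (InSumset≤-map swap-additive knight-swap (knight-horizontal m₂ ∣m₂∣≤a+b)))

    knight-reach : (a ℕ.+ b) % 2 ≡ 1 → ∀ x y → ∣ x ∣ ≤ a ℕ.+ b → ∣ y ∣ ≤ a ℕ.+ b →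
                   InSumset≤ {knight a b} (14 ℕ.* b) (x , y)
    knight-reach a+b-odd x y ∣x∣≤a+b ∣y∣≤a+b =
      let v , v-reach , m₁ , m₂ , ∣m₁∣≤a+b , ∣m₂∣≤a+b , xy≡ =
            knight-parity-split a+b-odd x y ∣x∣≤a+b ∣y∣≤a+b
      in InSumset≤-mono cost (subst (InSumset≤ _) (sym xy≡)
           (InSumset≤-⊕ v-reach (knight-even m₁ m₂ ∣m₁∣≤a+b ∣m₂∣≤a+b)))
      where
      sum≡14*n : ∀ n → 2 ℕ.* n ℕ.+ (6 ℕ.* n ℕ.+ 6 ℕ.* n) ≡ 14 ℕ.* n
      sum≡14*n = ℕ-Solver.solve-∀
      cost : 2 ℕ.+ (6 ℕ.* b ℕ.+ 6 ℕ.* b) ≤ 14 ℕ.* b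
      cost = ℕ.≤-trans (ℕ.+-monoˡ-≤ _ (ℕ.*-monoʳ-≤ 2 (ℕ.m<n⇒0<n a<b))) (ℕ.≤-reflexive (sum≡14*n b))

open KnightDistance using (InSumset≤⇒IsA; knight-reach)
open import Data.Nat using (ℕ; _*_; _+_; _<_; _≤_; NonZero; nonZero)

lemma2p1 : ∃ λ (C : ℕ) → NonZero C ×
    (∀ (a b : ℕ) → 1 ≤ a → a < b → gcd a b ≡ 1 → (a + b) % 2 ≡ 1 →
      ∀ (x y : ℤ) → ∣ x ∣ ≤ a + b → ∣ y ∣ ≤ a + b →
        ∃ λ (n : ℕ) → IsKnightDist a b (x , y) n × n ≤ C * b)
lemma2p1 = 14 , nonZero , λ a b _ a<b gcd≡1 a+b-odd x y ∣x∣≤a+b ∣y∣≤a+b →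
  InSumset≤⇒IsA (knight-reach a<b gcd≡1 a+b-odd x y ∣x∣≤a+b ∣y∣≤a+b)
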